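{- Let $n\ge 2$ and consider the Kreweras complement $\mathcal{K}$ (equivalently its inverse) acting on $S_n$. Then: (1) if $n$ is odd, the permutation $\frac{n+3}{2}\,\frac{n+5}{2}\cdots n\,1\,2\,3\cdots\frac{n+1}{2}$ (one-line notation) forms the unique orbit of size $1$; if $n$ is even there is no orbit of size $1$; (2) there are exactly $\lfloor n/2\rfloor$ orbits of size $2$, one of which is the orbit of the identity permutation; (3) the permutation $n(n-1)\cdots 321$ generates an orbit of size $n$; (4) for even $n>3$, the permutation $1\,3\,5\cdots(n-1)\,2\,4\cdots n$ generates an orbit of size $2n$, and for odd $n>3$, the permutation $1\,3\,5\cdots n\,2\,4\cdots(n-1)$ generates an orbit of size $2n$.
   Context: Permutations are in one-line notation and composed right to left. Let $c=234\cdots n1\in S_n$ (i.e. $c(i)=i+1$ for $i<n$, $c(n)=1$). The Kreweras complement is $\mathcal{K}:S_n\to S_n$, $\mathcal{K}(\sigma)=c\circ\sigma^{ -1}$, with inverse $\mathcal{K}^{ -1}(\sigma)=\sigma^{ -1}\circ c$; orbits of $\mathcal{K}$ and $\mathcal{K}^{ -1}$ coincide. -}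

module Defs where

open import Data.Nat using (ℕ; zero; suc; _+_; _*_; _∸_; _≤_; _<_; _≤ᵇ_)
open import Data.Nat.DivMod using (_/_)
open import Data.Bool using (if_then_else_)
open import Data.Fin using (Fin; toℕ)
open import Data.Fin.Patterns using (0F; 1F)
open import Data.Fin.Permutation using (Permutation′; _⟨$⟩ʳ_; _∘ₚ_; flip; id; lift₀; transpose; _≈_)
open import Data.Product using (Σ; ∃; _×_; _,_)
open import Data.Vec using (Vec; tabulate; lookup)
open import Data.List using (List; []; _∷_)
open import Relation.Binary.PropositionalEquality using (_≡_; refl)
open import Relation.Nullary using (¬_)
import Data.Vec as V

-- Permutations of [n] = {1,…,n} are represented (0-indexed) as
-- bijections Fin n ↔ Fin n; the one-line notation of σ is
-- (1 + toℕ (σ ⟨$⟩ʳ 0)) … (1 + toℕ (σ ⟨$⟩ʳ (n-1))).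
-- For π ρ : Permutation′ n, (π ∘ₚ ρ) ⟨$⟩ʳ i = ρ ⟨$⟩ʳ (π ⟨$⟩ʳ i)
-- (the stdlib's diagrammatic order), and permutations are equal iff
-- they agree pointwise (_≈_).

-- The long cycle c = 2 3 ⋯ n 1, i.e. c(i) = i+1 for i < n, c(n) = 1.
-- (0-indexed: i ↦ i+1 mod n.)  Built recursively:
-- c_{m+2} = transpose 0 1 ∘ lift₀ c_{m+1}.
cyc : (n : ℕ) → Permutation′ n
cyc zero          = id
cyc (suc zero)    = id
cyc (suc (suc m)) = lift₀ (cyc (suc m)) ∘ₚ transpose 0F 1F

private
  oneLine : {n : ℕ} → Permutation′ n → Vec ℕ n
  oneLine σ = tabulate (λ i → suc (toℕ (σ ⟨$⟩ʳ i)))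

  _ : oneLine (cyc 1) ≡ 1 V.∷ V.[]
  _ = refl
  _ : oneLine (cyc 2) ≡ 2 V.∷ 1 V.∷ V.[]
  _ = refl
  _ : oneLine (cyc 5) ≡ 2 V.∷ 3 V.∷ 4 V.∷ 5 V.∷ 1 V.∷ V.[]
  _ = refl

-- Kreweras complement  K(σ) = c ∘ σ⁻¹  (i ↦ c(σ⁻¹(i))).
kreweras : {n : ℕ} → Permutation′ n → Permutation′ n
kreweras {n} σ = flip σ ∘ₚ cyc n

krewerasIter : {n : ℕ} → ℕ → Permutation′ n → Permutation′ n
krewerasIter zero    σ = σ
krewerasIter (suc k) σ = kreweras (krewerasIter k σ)

OrbitSize : {n : ℕ} → Permutation′ n → ℕ → Set
OrbitSize σ k =
  1 ≤ k × krewerasIter k σ ≈ σ ×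
  (∀ j → 1 ≤ j → j < k → ¬ (krewerasIter j σ ≈ σ))

SameOrbit : {n : ℕ} → Permutation′ n → Permutation′ n → Set
SameOrbit σ τ = ∃ λ k → krewerasIter k σ ≈ τ

HasOneLine : {n : ℕ} → Permutation′ n → (ℕ → ℕ) → Set
HasOneLine σ w = ∀ i → suc (toℕ (σ ⟨$⟩ʳ i)) ≡ w (suc (toℕ i))

ExactlyOrbitsOfSize : (n m k : ℕ) → Set
ExactlyOrbitsOfSize n m k =
  Σ (Vec (Permutation′ n) m) λ reps →
    (∀ a → OrbitSize (lookup reps a) k) ×
    (∀ a b → SameOrbit (lookup reps a) (lookup reps b) → a ≡ b) ×
    (∀ σ → OrbitSize σ k → ∃ λ a → SameOrbit (lookup reps a) σ)

-- n odd: (n+3)/2 (n+5)/2 ⋯ n 1 2 ⋯ (n+1)/2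
shiftWord : ℕ → ℕ → ℕ
shiftWord n p = if p ≤ᵇ (n / 2) then p + suc (n / 2) else p ∸ (n / 2)

reverseWord : ℕ → ℕ → ℕ
reverseWord n p = suc n ∸ p

-- n even: 1 3 5 ⋯ (n-1) 2 4 ⋯ n
oddsEvensWordEven : ℕ → ℕ → ℕ
oddsEvensWordEven n p = if p ≤ᵇ (n / 2) then 2 * p ∸ 1 else 2 * (p ∸ (n / 2))

-- n odd: 1 3 5 ⋯ n 2 4 ⋯ (n-1)
oddsEvensWordOdd : ℕ → ℕ → ℕ
oddsEvensWordOdd n p = if p ≤ᵇ suc (n / 2) then 2 * p ∸ 1 else 2 * (p ∸ suc (n / 2))

private
  w : (ℕ → ℕ) → (n : ℕ) → List ℕ
  w f n = go n where
    go : ℕ → List ℕ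
    go zero = []
    go (suc k) = f (n ∸ k) ∷ go k
  _ : w (shiftWord 7) 7 ≡ 5 ∷ 6 ∷ 7 ∷ 1 ∷ 2 ∷ 3 ∷ 4 ∷ []
  _ = refl
  _ : w (oddsEvensWordEven 6) 6 ≡ 1 ∷ 3 ∷ 5 ∷ 2 ∷ 4 ∷ 6 ∷ []
  _ = refl
  _ : w (oddsEvensWordOdd 7) 7 ≡ 1 ∷ 3 ∷ 5 ∷ 7 ∷ 2 ∷ 4 ∷ 6 ∷ []
  _ = refl
  _ : w (reverseWord 4) 4 ≡ 4 ∷ 3 ∷ 2 ∷ 1 ∷ []
  _ = refl

-- Identify positions with ℤ/n, so that c is i ↦ i + 1. Since K σ = c σ⁻¹, K² σ = c σ c⁻¹:
-- K^{2k} σ = σ says σ (i + k) = σ i + k, and K^{2k+1} σ = σ says σ (i + k) = σ⁻¹ i + k + 1.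
-- In particular K^{2n} = id, and K² σ = σ exactly for the rotations i ↦ i + a, on which K acts
-- as a ↦ 1 - a. A rotation is fixed iff 2a ≡ 1, which is solvable (by a = (n+1)/2) iff n is odd;
-- the other rotations pair up as {a, 1 - a}, one orbit for each a = 1, …, ⌊n/2⌋. The reversal
-- is the reflection i ↦ -1 - i, and K maps i ↦ b - i to i ↦ b + 1 - i, so its orbit has size n.
-- For the two odds-then-evens permutations (i ↦ 2i when n is odd, the perfect unshuffle when n
-- is even), evaluating the two identities above at one or two points rules out every period
-- below 2n.
module Submission where

open import Defs
open import Data.Nat
open import Data.Nat.Properties
open import Data.Nat.DivMod
open import Data.Nat.GeneralisedArithmetic using (fold)
open import Data.Nat.Tactic.RingSolver using (solve-∀)
open import Data.Bool using (if_then_else_)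
open import Data.Fin using (Fin; zero; suc; toℕ; fromℕ; fromℕ<)
open import Data.Fin.Properties using (toℕ<n; toℕ-injective; toℕ-fromℕ; toℕ-fromℕ<)
open import Data.Fin.Permutation
  using (Permutation′; _⟨$⟩ʳ_; _⟨$⟩ˡ_; id; _≈_; permutation; inverseˡ; inverseʳ)
open import Data.Product using (∃; _×_; _,_; proj₁; proj₂)
open import Data.Sum using (_⊎_; inj₁; inj₂)
open import Data.Empty using (⊥-elim)
open import Data.Vec using (Vec; tabulate; lookup)
open import Data.Vec.Properties using (lookup∘tabulate)
open import Level using (0ℓ)
open import Relation.Binary.Bundles using (Setoid)
open import Relation.Binary.PropositionalEquality
open import Relation.Nullary using (¬_; yes; no)
import Relation.Binary.Reasoning.Setoid as SetoidReasoning

double : ℕ → ℕ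
double zero    = zero
double (suc k) = suc (suc (double k))

double≡2* : ∀ k → double k ≡ 2 * k
double≡2* zero    = refl
double≡2* (suc k) = cong suc (trans (cong suc (double≡2* k)) (sym (+-suc k (k + 0))))

double≡+ : ∀ k → double k ≡ k + k
double≡+ k = trans (double≡2* k) (cong (k +_) (+-identityʳ k))

even-or-odd : ∀ j → ∃ λ k → j ≡ double k ⊎ j ≡ suc (double k)
even-or-odd zero = zero , inj₁ refl
even-or-odd (suc j) with even-or-odd j
... | k , inj₁ j≡2k   = k , inj₂ (cong suc j≡2k)
... | k , inj₂ j≡2k+1 = suc k , inj₁ (cong suc j≡2k+1)

m+m≡n+n⇒m≡n : ∀ {m n} → m + m ≡ n + n → m ≡ n
m+m≡n+n⇒m≡n {m} {n} eq = trans (n≡⌊n+n/2⌋ m) (trans (cong ⌊_/2⌋ eq) (sym (n≡⌊n+n/2⌋ n)))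

m+m≢1+n+n : ∀ m n → m + m ≢ suc (n + n)
m+m≢1+n+n zero    n       ()
m+m≢1+n+n (suc m) zero    eq = 1+n≢0 (suc-injective (trans (cong suc (sym (+-suc m m))) eq))
m+m≢1+n+n (suc m) (suc n) eq =
  m+m≢1+n+n m n (suc-injective (suc-injective
    (trans (cong suc (sym (+-suc m m))) (trans eq (cong (λ k → suc (suc k)) (+-suc n n))))))

if-<ᵇ : ∀ {A : Set} {x y : A} {m n} → m < n → (if m <ᵇ n then x else y) ≡ x
if-<ᵇ {m = zero}  {suc n} _         = refl
if-<ᵇ {m = suc m} {suc n} (s≤s m<n) = if-<ᵇ m<n

if-≮ᵇ : ∀ {A : Set} {x y : A} {m n} → n ≤ m → (if m <ᵇ n then x else y) ≡ y
if-≮ᵇ {n = zero}          _         = refl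
if-≮ᵇ {m = suc m} {suc n} (s≤s n≤m) = if-≮ᵇ n≤m

double-cancel-< : ∀ {k n} → double k < double n → k < n
double-cancel-< {zero}  {suc n} _               = s≤s z≤n
double-cancel-< {suc k} {suc n} (s≤s (s≤s 2k<2n)) = s≤s (double-cancel-< 2k<2n)

1+double<double : ∀ {k n} → k < n → suc (double k) < double n
1+double<double {zero}  {suc n} _         = s≤s (s≤s z≤n)
1+double<double {suc k} {suc n} (s≤s k<n) = s≤s (s≤s (1+double<double k<n))

2*-suc : ∀ x → 2 * suc x ≡ suc (suc (2 * x))
2*-suc x = cong suc (+-suc x (x + 0))

fold-shift : ∀ {A : Set} (f : A → A) x k → fold (f x) f k ≡ f (fold x f k)
fold-shift f x zero    = refl
fold-shift f x (suc k) = cong f (fold-shift f x k)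

toℕ-cyc : ∀ m (i : Fin (suc m)) → toℕ (cyc (suc m) ⟨$⟩ʳ i) ≡ suc (toℕ i) % suc m
toℕ-cyc zero    zero    = refl
toℕ-cyc (suc m) zero    = refl
toℕ-cyc (suc m) (suc j) with cyc (suc m) ⟨$⟩ʳ j | toℕ-cyc m j
... | zero | ih with m≤n⇒m<n∨m≡n (toℕ<n j)
...   | inj₁ j<m = ⊥-elim (0≢1+n (trans ih (m<n⇒m%n≡m j<m)))
...   | inj₂ j≡m = sym (trans (cong (λ x → suc x % suc (suc m)) j≡m) (n%n≡0 (suc (suc m))))
toℕ-cyc (suc m) (suc j) | suc k | ih with m≤n⇒m<n∨m≡n (toℕ<n j)
...   | inj₁ j<m = sym (trans (m<n⇒m%n≡m (s≤s j<m)) (cong suc (sym (trans ih (m<n⇒m%n≡m j<m)))))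
...   | inj₂ j≡m = ⊥-elim (1+n≢0 (trans ih (trans (cong (λ x → x % suc m) j≡m) (n%n≡0 (suc m)))))

record RangePermutation (n : ℕ) : Set where
  field
    to from       : ℕ → ℕ
    to-<          : ∀ {x} → x < n → to x < n
    from-<        : ∀ {x} → x < n → from x < n
    from∘to       : ∀ {x} → x < n → from (to x) ≡ x
    to∘from       : ∀ {x} → x < n → to (from x) ≡ x

module _ {n : ℕ} (π : RangePermutation n) where
  open RangePermutation π

  toPermutation : Permutation′ n
  toPermutation = permutation to′ from′ to′∘from′ from′∘to′
    where
    to′ from′ : Fin n → Fin n
    to′   i = fromℕ< (to-< (toℕ<n i))
    from′ i = fromℕ< (from-< (toℕ<n i))
    to′∘from′ : ∀ i → to′ (from′ i) ≡ i
    to′∘from′ i = toℕ-injective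
      (trans (toℕ-fromℕ< _) (trans (cong to (toℕ-fromℕ< _)) (to∘from (toℕ<n i))))
    from′∘to′ : ∀ i → from′ (to′ i) ≡ i
    from′∘to′ i = toℕ-injective
      (trans (toℕ-fromℕ< _) (trans (cong from (toℕ-fromℕ< _)) (from∘to (toℕ<n i))))

  toℕ-toPermutationʳ : ∀ i → toℕ (toPermutation ⟨$⟩ʳ i) ≡ to (toℕ i)
  toℕ-toPermutationʳ i = toℕ-fromℕ< _

  toℕ-toPermutationˡ : ∀ i → toℕ (toPermutation ⟨$⟩ˡ i) ≡ from (toℕ i)
  toℕ-toPermutationˡ i = toℕ-fromℕ< _

module _ {n : ℕ} where
  cyc^ : ℕ → Fin n → Fin n
  cyc^ k i = fold i (cyc n ⟨$⟩ʳ_) k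

  cyc⁻^ : ℕ → Fin n → Fin n
  cyc⁻^ k i = fold i (cyc n ⟨$⟩ˡ_) k

  cyc⁻^-cyc^ : ∀ k i → cyc⁻^ k (cyc^ k i) ≡ i
  cyc⁻^-cyc^ zero    i = refl
  cyc⁻^-cyc^ (suc k) i = begin
    cyc⁻^ (suc k) (cyc^ (suc k) i)              ≡⟨ fold-shift (cyc n ⟨$⟩ˡ_) _ k ⟨
    cyc⁻^ k (cyc n ⟨$⟩ˡ (cyc n ⟨$⟩ʳ cyc^ k i))  ≡⟨ cong (cyc⁻^ k) (inverseˡ (cyc n)) ⟩
    cyc⁻^ k (cyc^ k i)                          ≡⟨ cyc⁻^-cyc^ k i ⟩
    i                                           ∎
    where open ≡-Reasoning

  -- K (K σ) ⟨$⟩ʳ i reduces to c (σ (c⁻¹ i)): K² is conjugation by c.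
  krewerasIter-doubleʳ : ∀ (σ : Permutation′ n) k i →
    krewerasIter (double k) σ ⟨$⟩ʳ i ≡ cyc^ k (σ ⟨$⟩ʳ cyc⁻^ k i)
  krewerasIter-doubleʳ σ zero    i = refl
  krewerasIter-doubleʳ σ (suc k) i = cong (cyc n ⟨$⟩ʳ_)
    (trans (krewerasIter-doubleʳ σ k _) (cong (λ j → cyc^ k (σ ⟨$⟩ʳ j)) (fold-shift _ i k)))

  krewerasIter-doubleˡ : ∀ (σ : Permutation′ n) k i →
    krewerasIter (double k) σ ⟨$⟩ˡ i ≡ cyc^ k (σ ⟨$⟩ˡ cyc⁻^ k i)
  krewerasIter-doubleˡ σ zero    i = refl
  krewerasIter-doubleˡ σ (suc k) i = cong (cyc n ⟨$⟩ʳ_)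
    (trans (krewerasIter-doubleˡ σ k _) (cong (λ j → cyc^ k (σ ⟨$⟩ˡ j)) (fold-shift _ i k)))

  commute-cyc^ : ∀ {σ : Permutation′ n} k → krewerasIter (double k) σ ≈ σ →
    ∀ i → σ ⟨$⟩ʳ cyc^ k i ≡ cyc^ k (σ ⟨$⟩ʳ i)
  commute-cyc^ {σ} k K²ᵏσ≈σ i = begin
    σ ⟨$⟩ʳ cyc^ k i                              ≡⟨ K²ᵏσ≈σ (cyc^ k i) ⟨
    krewerasIter (double k) σ ⟨$⟩ʳ cyc^ k i      ≡⟨ krewerasIter-doubleʳ σ k _ ⟩
    cyc^ k (σ ⟨$⟩ʳ cyc⁻^ k (cyc^ k i))           ≡⟨ cong (λ j → cyc^ k (σ ⟨$⟩ʳ j)) (cyc⁻^-cyc^ k i) ⟩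
    cyc^ k (σ ⟨$⟩ʳ i)                            ∎
    where open ≡-Reasoning

  anticommute-cyc^ : ∀ {σ : Permutation′ n} k → krewerasIter (suc (double k)) σ ≈ σ →
    ∀ i → σ ⟨$⟩ʳ cyc^ k i ≡ cyc^ (suc k) (σ ⟨$⟩ˡ i)
  anticommute-cyc^ {σ} k K²ᵏ⁺¹σ≈σ i = begin
    σ ⟨$⟩ʳ cyc^ k i                                          ≡⟨ K²ᵏ⁺¹σ≈σ (cyc^ k i) ⟨
    cyc n ⟨$⟩ʳ (krewerasIter (double k) σ ⟨$⟩ˡ cyc^ k i)     ≡⟨ cong (cyc n ⟨$⟩ʳ_) (krewerasIter-doubleˡ σ k _) ⟩
    cyc n ⟨$⟩ʳ cyc^ k (σ ⟨$⟩ˡ cyc⁻^ k (cyc^ k i))            ≡⟨ cong (λ j → cyc^ (suc k) (σ ⟨$⟩ˡ j)) (cyc⁻^-cyc^ k i) ⟩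
    cyc^ (suc k) (σ ⟨$⟩ˡ i)                                  ∎
    where open ≡-Reasoning

  commute⇒commute-cyc^ : ∀ {σ : Permutation′ n} →
    (∀ i → σ ⟨$⟩ʳ (cyc n ⟨$⟩ʳ i) ≡ cyc n ⟨$⟩ʳ (σ ⟨$⟩ʳ i)) →
    ∀ k i → σ ⟨$⟩ʳ cyc^ k i ≡ cyc^ k (σ ⟨$⟩ʳ i)
  commute⇒commute-cyc^ σc≡cσ zero    i = refl
  commute⇒commute-cyc^ {σ} σc≡cσ (suc k) i =
    trans (σc≡cσ (cyc^ k i)) (cong (cyc n ⟨$⟩ʳ_) (commute⇒commute-cyc^ {σ} σc≡cσ k i))

  kreweras-cong : ∀ {σ τ : Permutation′ n} → σ ≈ τ → kreweras σ ≈ kreweras τ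
  kreweras-cong {σ} {τ} σ≈τ i = cong (cyc n ⟨$⟩ʳ_) (begin
    σ ⟨$⟩ˡ i                        ≡⟨ inverseˡ τ ⟨
    τ ⟨$⟩ˡ (τ ⟨$⟩ʳ (σ ⟨$⟩ˡ i))      ≡⟨ cong (τ ⟨$⟩ˡ_) (σ≈τ _) ⟨
    τ ⟨$⟩ˡ (σ ⟨$⟩ʳ (σ ⟨$⟩ˡ i))      ≡⟨ cong (τ ⟨$⟩ˡ_) (inverseʳ σ) ⟩
    τ ⟨$⟩ˡ i                        ∎)
    where open ≡-Reasoning

-- Arithmetic modulo N

module Modulo (p : ℕ) where
  N N-1 : ℕ
  N   = suc (suc p)
  N-1 = suc p

  infix 4 _≡ₘ_
  record _≡ₘ_ (x y : ℕ) : Set where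
    constructor mk
    field un : x % N ≡ y % N
  open _≡ₘ_ public

  ≡ₘ-refl : ∀ {x} → x ≡ₘ x
  ≡ₘ-refl = mk refl

  ≡ₘ-sym : ∀ {x y} → x ≡ₘ y → y ≡ₘ x
  ≡ₘ-sym (mk e) = mk (sym e)

  ≡ₘ-trans : ∀ {x y z} → x ≡ₘ y → y ≡ₘ z → x ≡ₘ z
  ≡ₘ-trans (mk e) (mk f) = mk (trans e f)

  ≡⇒≡ₘ : ∀ {x y} → x ≡ y → x ≡ₘ y
  ≡⇒≡ₘ e = mk (cong (_% N) e)

  ≡ₘ-setoid : Setoid 0ℓ 0ℓ
  ≡ₘ-setoid = record
    { Carrier = ℕ ; _≈_ = _≡ₘ_
    ; isEquivalence = record { refl = ≡ₘ-refl ; sym = ≡ₘ-sym ; trans = ≡ₘ-trans } }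

  module ≡ₘ-Reasoning = SetoidReasoning ≡ₘ-setoid

  %-≡ₘ : ∀ x → x % N ≡ₘ x
  %-≡ₘ x = mk (m%n%n≡m%n x N)

  +-*N-≡ₘ : ∀ x k → x + k * N ≡ₘ x
  +-*N-≡ₘ x k = mk ([m+kn]%n≡m%n x k N)

  +-N-≡ₘ : ∀ x → x + N ≡ₘ x
  +-N-≡ₘ x = ≡ₘ-trans (≡⇒≡ₘ (cong (x +_) (sym (+-identityʳ N)))) (+-*N-≡ₘ x 1)

  N≡ₘ0 : N ≡ₘ 0
  N≡ₘ0 = +-N-≡ₘ 0

  1+N≡ₘ1 : suc N ≡ₘ 1
  1+N≡ₘ1 = +-N-≡ₘ 1

  +-congₘ : ∀ {a b c d} → a ≡ₘ b → c ≡ₘ d → a + c ≡ₘ b + d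
  +-congₘ {a} {b} {c} {d} (mk e) (mk f) = mk (begin
    (a + c) % N                ≡⟨ %-distribˡ-+ a c N ⟩
    (a % N + c % N) % N        ≡⟨ cong₂ (λ x y → (x + y) % N) e f ⟩
    (b % N + d % N) % N        ≡⟨ %-distribˡ-+ b d N ⟨
    (b + d) % N                ∎)
    where open ≡-Reasoning

  *-congₘ : ∀ {a b c d} → a ≡ₘ b → c ≡ₘ d → a * c ≡ₘ b * d
  *-congₘ {a} {b} {c} {d} (mk e) (mk f) = mk (begin
    (a * c) % N                ≡⟨ %-distribˡ-* a c N ⟩
    (a % N * (c % N)) % N      ≡⟨ cong₂ (λ x y → (x * y) % N) e f ⟩
    (b % N * (d % N)) % N      ≡⟨ %-distribˡ-* b d N ⟨
    (b * d) % N                ∎)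
    where open ≡-Reasoning

  +-congˡₘ : ∀ a {c d} → c ≡ₘ d → a + c ≡ₘ a + d
  +-congˡₘ a = +-congₘ {a} ≡ₘ-refl

  *-congˡₘ : ∀ a {c d} → c ≡ₘ d → a * c ≡ₘ a * d
  *-congˡₘ a = *-congₘ {a} ≡ₘ-refl

  -- Cancelling c amounts to adding (N-1) c, since c + (N-1) c = c N.
  +-cancelʳ-≡ₘ : ∀ {a b} c → a + c ≡ₘ b + c → a ≡ₘ b
  +-cancelʳ-≡ₘ {a} {b} c eq = begin
    a                        ≈⟨ +-*N-≡ₘ a c ⟨
    a + c * N                ≡⟨ regroup a c p ⟩
    (a + c) + N-1 * c        ≈⟨ +-congₘ eq ≡ₘ-refl ⟩
    (b + c) + N-1 * c        ≡⟨ regroup b c p ⟨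
    b + c * N                ≈⟨ +-*N-≡ₘ b c ⟩
    b                        ∎
    where
    open ≡ₘ-Reasoning
    regroup : ∀ x c p → x + c * suc (suc p) ≡ (x + c) + suc p * c
    regroup = solve-∀

  N-1*N-1≡ₘ1 : N-1 * N-1 ≡ₘ 1
  N-1*N-1≡ₘ1 = ≡ₘ-trans (≡⇒≡ₘ (square p)) (+-*N-≡ₘ 1 p)
    where
    square : ∀ p → suc p * suc p ≡ 1 + p * suc (suc p)
    square = solve-∀

  ≡ₘ⇒≡ : ∀ {x y} → x < N → y < N → x ≡ₘ y → x ≡ y
  ≡ₘ⇒≡ x<N y<N (mk e) = trans (sym (m<n⇒m%n≡m x<N)) (trans e (m<n⇒m%n≡m y<N))

  toℕ-injectiveₘ : {i j : Fin N} → toℕ i ≡ₘ toℕ j → i ≡ j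
  toℕ-injectiveₘ {i} {j} e = toℕ-injective (≡ₘ⇒≡ (toℕ<n i) (toℕ<n j) e)

  c : Permutation′ N
  c = cyc N

  toℕ-cycʳ : ∀ i → toℕ (c ⟨$⟩ʳ i) ≡ₘ suc (toℕ i)
  toℕ-cycʳ i = ≡ₘ-trans (≡⇒≡ₘ (toℕ-cyc N-1 i)) (%-≡ₘ (suc (toℕ i)))

  toℕ-cycˡ : ∀ i → toℕ (c ⟨$⟩ˡ i) ≡ₘ N-1 + toℕ i
  toℕ-cycˡ i = ≡ₘ-sym (begin
    N-1 + toℕ i                         ≡⟨ cong (λ j → N-1 + toℕ j) (inverseʳ c) ⟨
    N-1 + toℕ (c ⟨$⟩ʳ (c ⟨$⟩ˡ i))       ≈⟨ +-congˡₘ N-1 (toℕ-cycʳ _) ⟩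
    N-1 + suc (toℕ (c ⟨$⟩ˡ i))          ≡⟨ +-suc N-1 _ ⟩
    N + toℕ (c ⟨$⟩ˡ i)                  ≡⟨ +-comm N _ ⟩
    toℕ (c ⟨$⟩ˡ i) + N                  ≈⟨ +-N-≡ₘ _ ⟩
    toℕ (c ⟨$⟩ˡ i)                      ∎)
    where open ≡ₘ-Reasoning

  toℕ-cyc^ : ∀ k i → toℕ (cyc^ k i) ≡ₘ toℕ i + k
  toℕ-cyc^ zero    i = ≡⇒≡ₘ (sym (+-identityʳ (toℕ i)))
  toℕ-cyc^ (suc k) i = ≡ₘ-trans (toℕ-cycʳ (cyc^ k i))
    (≡ₘ-trans (+-congˡₘ 1 (toℕ-cyc^ k i)) (≡⇒≡ₘ (sym (+-suc (toℕ i) k))))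

  cyc^-wrap : ∀ {k i} → toℕ i + k ≡ N → cyc^ k i ≡ zero
  cyc^-wrap {k} {i} i+k≡N = toℕ-injectiveₘ (≡ₘ-trans (toℕ-cyc^ k i) (≡ₘ-trans (≡⇒≡ₘ i+k≡N) N≡ₘ0))

  cyc^-N : ∀ i → cyc^ N i ≡ i
  cyc^-N i = toℕ-injectiveₘ (≡ₘ-trans (toℕ-cyc^ N i) (+-N-≡ₘ (toℕ i)))

  krewerasIter-2N : ∀ σ → krewerasIter (double N) σ ≈ σ
  krewerasIter-2N σ i = begin
    krewerasIter (double N) σ ⟨$⟩ʳ i    ≡⟨ krewerasIter-doubleʳ σ N i ⟩
    cyc^ N (σ ⟨$⟩ʳ cyc⁻^ N i)           ≡⟨ cyc^-N _ ⟩
    σ ⟨$⟩ʳ cyc⁻^ N i                    ≡⟨ cong (λ j → σ ⟨$⟩ʳ cyc⁻^ N j) (cyc^-N i) ⟨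
    σ ⟨$⟩ʳ cyc⁻^ N (cyc^ N i)           ≡⟨ cong (σ ⟨$⟩ʳ_) (cyc⁻^-cyc^ N i) ⟩
    σ ⟨$⟩ʳ i                            ∎
    where open ≡-Reasoning

  -- Affine permutations of ℤ/N

  record Affine (f : Fin N → Fin N) (a s : ℕ) : Set where
    constructor affine
    field apply : ∀ i → toℕ (f i) ≡ₘ a + s * toℕ i
  open Affine public

  record AffinePermutation (σ : Permutation′ N) (a s b t : ℕ) : Set where
    constructor _,_
    field
      forward  : Affine (σ ⟨$⟩ʳ_) a s
      backward : Affine (σ ⟨$⟩ˡ_) b t
  open AffinePermutation public

  Affine-resp : ∀ {f a s a′ s′} → Affine f a s → a ≡ₘ a′ → s ≡ₘ s′ → Affine f a′ s′
  Affine-resp (affine h) a≡a′ s≡s′ = affine λ i → ≡ₘ-trans (h i) (+-congₘ a≡a′ (*-congₘ s≡s′ ≡ₘ-refl))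

  Affine-at-0 : ∀ {f a s} → Affine f a s → toℕ (f zero) ≡ₘ a
  Affine-at-0 {a = a} {s} (affine h) =
    ≡ₘ-trans (h zero) (≡⇒≡ₘ (trans (cong (a +_) (*-zeroʳ s)) (+-identityʳ a)))

  Affine⇒≈ : ∀ {σ τ a s} → Affine (σ ⟨$⟩ʳ_) a s → Affine (τ ⟨$⟩ʳ_) a s → σ ≈ τ
  Affine⇒≈ (affine hσ) (affine hτ) i = toℕ-injectiveₘ (≡ₘ-trans (hσ i) (≡ₘ-sym (hτ i)))

  ≈⇒Affine-offset : ∀ {σ τ a s a′ s′} → σ ≈ τ →
    Affine (σ ⟨$⟩ʳ_) a s → Affine (τ ⟨$⟩ʳ_) a′ s′ → a ≡ₘ a′
  ≈⇒Affine-offset σ≈τ hσ hτ =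
    ≡ₘ-trans (≡ₘ-sym (Affine-at-0 hσ)) (≡ₘ-trans (≡⇒≡ₘ (cong toℕ (σ≈τ zero))) (Affine-at-0 hτ))

  affine-cancel : ∀ {a s b t} → t * s ≡ₘ 1 → b + t * a ≡ₘ 0 → ∀ x → b + t * (a + s * x) ≡ₘ x
  affine-cancel {a} {s} {b} {t} ts≡1 b+ta≡0 x = begin
    b + t * (a + s * x)        ≡⟨ distrib b t a s x ⟩
    (b + t * a) + t * s * x    ≈⟨ +-congₘ b+ta≡0 (*-congₘ ts≡1 ≡ₘ-refl) ⟩
    0 + 1 * x                  ≡⟨ *-identityˡ x ⟩
    x                          ∎
    where
    open ≡ₘ-Reasoning
    distrib : ∀ b t a s x → b + t * (a + s * x) ≡ (b + t * a) + t * s * x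
    distrib = solve-∀

  affine-inverse-sym : ∀ {a s b t} → t * s ≡ₘ 1 → b + t * a ≡ₘ 0 → s * t ≡ₘ 1 × a + s * b ≡ₘ 0
  affine-inverse-sym {a} {s} {b} {t} ts≡1 b+ta≡0 = ≡ₘ-trans (≡⇒≡ₘ (*-comm s t)) ts≡1 , (begin
    a + s * b              ≡⟨ cong (_+ s * b) (*-identityˡ a) ⟨
    1 * a + s * b          ≈⟨ +-congₘ (*-congₘ (≡ₘ-sym ts≡1) ≡ₘ-refl) ≡ₘ-refl ⟩
    t * s * a + s * b      ≡⟨ distrib a s b t ⟩
    s * (b + t * a)        ≈⟨ *-congˡₘ s b+ta≡0 ⟩
    s * 0                  ≡⟨ *-zeroʳ s ⟩
    0                      ∎)
    where
    open ≡ₘ-Reasoning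
    distrib : ∀ a s b t → t * s * a + s * b ≡ s * (b + t * a)
    distrib = solve-∀

  affineRange : ∀ a s b t → t * s ≡ₘ 1 → b + t * a ≡ₘ 0 → RangePermutation N
  affineRange a s b t ts≡1 b+ta≡0 = record
    { to      = λ x → (a + s * x) % N
    ; from    = λ x → (b + t * x) % N
    ; to-<    = λ {x} _ → m%n<n (a + s * x) N
    ; from-<  = λ {x} _ → m%n<n (b + t * x) N
    ; from∘to = inverts a s b t ts≡1 b+ta≡0
    ; to∘from = inverts b t a s (proj₁ st) (proj₂ st)
    }
    where
    st = affine-inverse-sym {a} {s} {b} {t} ts≡1 b+ta≡0
    inverts : ∀ a s b t → t * s ≡ₘ 1 → b + t * a ≡ₘ 0 →
      ∀ {x} → x < N → (b + t * ((a + s * x) % N)) % N ≡ x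
    inverts a s b t ts≡1 b+ta≡0 {x} x<N = trans
      (un (≡ₘ-trans (+-congˡₘ b (*-congˡₘ t (%-≡ₘ (a + s * x))))
                    (affine-cancel {a} {s} {b} {t} ts≡1 b+ta≡0 x)))
      (m<n⇒m%n≡m x<N)

  affinePermutation : ∀ a s b t → t * s ≡ₘ 1 → b + t * a ≡ₘ 0 → Permutation′ N
  affinePermutation a s b t ts≡1 b+ta≡0 = toPermutation (affineRange a s b t ts≡1 b+ta≡0)

  affinePermutation-affine : ∀ a s b t ts≡1 b+ta≡0 →
    AffinePermutation (affinePermutation a s b t ts≡1 b+ta≡0) a s b t
  affinePermutation-affine a s b t ts≡1 b+ta≡0 =
    affine (λ i → ≡ₘ-trans (≡⇒≡ₘ (toℕ-toPermutationʳ π i)) (%-≡ₘ _)) ,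
    affine (λ i → ≡ₘ-trans (≡⇒≡ₘ (toℕ-toPermutationˡ π i)) (%-≡ₘ _))
    where π = affineRange a s b t ts≡1 b+ta≡0

  Affine⇒Affine⁻¹ : ∀ {σ a s b t} → Affine (σ ⟨$⟩ʳ_) a s →
    t * s ≡ₘ 1 → b + t * a ≡ₘ 0 → Affine (σ ⟨$⟩ˡ_) b t
  Affine⇒Affine⁻¹ {σ} {a} {s} {b} {t} (affine h) ts≡1 b+ta≡0 = affine λ i → ≡ₘ-sym (begin
    b + t * toℕ i                       ≡⟨ cong (λ j → b + t * toℕ j) (inverseʳ σ) ⟨
    b + t * toℕ (σ ⟨$⟩ʳ (σ ⟨$⟩ˡ i))     ≈⟨ +-congˡₘ b (*-congˡₘ t (h _)) ⟩
    b + t * (a + s * toℕ (σ ⟨$⟩ˡ i))    ≈⟨ affine-cancel {a} {s} {b} {t} ts≡1 b+ta≡0 _ ⟩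
    toℕ (σ ⟨$⟩ˡ i)                      ∎)
    where open ≡ₘ-Reasoning

  kreweras-affine : ∀ {σ a s b t} → AffinePermutation σ a s b t →
    AffinePermutation (kreweras σ) (suc b) t (a + N-1 * s) s
  kreweras-affine {σ} {a} {s} {b} {t} (affine hʳ , affine hˡ) =
    affine (λ i → ≡ₘ-trans (toℕ-cycʳ (σ ⟨$⟩ˡ i)) (+-congˡₘ 1 (hˡ i))) ,
    affine λ i → begin
      toℕ (σ ⟨$⟩ʳ (c ⟨$⟩ˡ i))     ≈⟨ hʳ _ ⟩
      a + s * toℕ (c ⟨$⟩ˡ i)      ≈⟨ +-congˡₘ a (*-congˡₘ s (toℕ-cycˡ i)) ⟩
      a + s * (N-1 + toℕ i)       ≡⟨ distrib a s (toℕ i) p ⟩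
      a + N-1 * s + s * toℕ i     ∎
    where
    open ≡ₘ-Reasoning
    distrib : ∀ a s x p → a + s * (suc p + x) ≡ a + suc p * s + s * x
    distrib = solve-∀

  -- 1 - a modulo N, as N-1 ≡ -1
  oneMinus : ℕ → ℕ
  oneMinus a = suc (N-1 * a)

  oneMinus+≡ₘ1 : ∀ a → oneMinus a + a ≡ₘ 1
  oneMinus+≡ₘ1 a = ≡ₘ-trans (≡⇒≡ₘ (expand a p)) (+-*N-≡ₘ 1 a)
    where
    expand : ∀ a p → suc (suc p * a) + a ≡ 1 + a * suc (suc p)
    expand = solve-∀

  oneMinus-involutive : ∀ a → oneMinus (oneMinus a) ≡ₘ a
  oneMinus-involutive a = ≡ₘ-trans (≡⇒≡ₘ (expand a p)) (+-*N-≡ₘ a (suc (p * a)))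
    where
    expand : ∀ a p → suc (suc p * suc (suc p * a)) ≡ a + suc (p * a) * suc (suc p)
    expand = solve-∀

  -- Rotations: the orbits of size 1 and 2

  Rotation : Permutation′ N → ℕ → Set
  Rotation σ a = AffinePermutation σ a 1 (N-1 * a) 1

  N-1*a+a≡ₘ0 : ∀ a → N-1 * a + 1 * a ≡ₘ 0
  N-1*a+a≡ₘ0 a = ≡ₘ-trans (≡⇒≡ₘ (expand a p)) (+-*N-≡ₘ 0 a)
    where
    expand : ∀ a p → suc p * a + 1 * a ≡ 0 + a * suc (suc p)
    expand = solve-∀

  rotation : ℕ → Permutation′ N
  rotation a = affinePermutation a 1 (N-1 * a) 1 ≡ₘ-refl (N-1*a+a≡ₘ0 a)

  rotation-isRotation : ∀ a → Rotation (rotation a) a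
  rotation-isRotation a = affinePermutation-affine a 1 (N-1 * a) 1 ≡ₘ-refl (N-1*a+a≡ₘ0 a)

  Rotation-resp : ∀ {σ a a′} → Rotation σ a → a ≡ₘ a′ → Rotation σ a′
  Rotation-resp (hʳ , hˡ) a≡a′ = Affine-resp hʳ a≡a′ ≡ₘ-refl , Affine-resp hˡ (*-congˡₘ N-1 a≡a′) ≡ₘ-refl

  kreweras-rotation : ∀ {σ a} → Rotation σ a → Rotation (kreweras σ) (oneMinus a)
  kreweras-rotation {σ} {a} ρ = forward Kρ ,
    Affine-resp (backward Kρ) (≡ₘ-trans (≡ₘ-sym (+-*N-≡ₘ _ (p * a))) (≡⇒≡ₘ (expand a p))) ≡ₘ-refl
    where
    Kρ = kreweras-affine ρ
    expand : ∀ a p → (a + suc p * 1) + p * a * suc (suc p) ≡ suc p * suc (suc p * a)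
    expand = solve-∀

  krewerasIter-double-rotation : ∀ {σ a} → Rotation σ a → ∀ k → Rotation (krewerasIter (double k) σ) a
  krewerasIter-double-rotation ρ zero    = ρ
  krewerasIter-double-rotation {a = a} ρ (suc k) = Rotation-resp
    (kreweras-rotation (kreweras-rotation (krewerasIter-double-rotation ρ k))) (oneMinus-involutive a)

  cyc^-toℕ : ∀ i → cyc^ (toℕ i) zero ≡ i
  cyc^-toℕ i = toℕ-injectiveₘ (toℕ-cyc^ (toℕ i) zero)

  commuting⇒Rotation : ∀ {σ} → kreweras (kreweras σ) ≈ σ → Rotation σ (toℕ (σ ⟨$⟩ʳ zero))
  commuting⇒Rotation {σ} K²σ≈σ = hʳ , Affine⇒Affine⁻¹ {σ} hʳ ≡ₘ-refl (N-1*a+a≡ₘ0 a)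
    where
    a = toℕ (σ ⟨$⟩ʳ zero)
    hʳ : Affine (σ ⟨$⟩ʳ_) a 1
    hʳ = affine λ i → begin
      toℕ (σ ⟨$⟩ʳ i)                      ≡⟨ cong (λ j → toℕ (σ ⟨$⟩ʳ j)) (cyc^-toℕ i) ⟨
      toℕ (σ ⟨$⟩ʳ cyc^ (toℕ i) zero)      ≡⟨ cong toℕ (commute⇒commute-cyc^ {σ = σ} (commute-cyc^ {σ = σ} 1 K²σ≈σ) (toℕ i) zero) ⟩
      toℕ (cyc^ (toℕ i) (σ ⟨$⟩ʳ zero))    ≈⟨ toℕ-cyc^ (toℕ i) _ ⟩
      a + toℕ i                           ≡⟨ cong (a +_) (*-identityˡ (toℕ i)) ⟨
      a + 1 * toℕ i                       ∎
      where open ≡ₘ-Reasoning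

  Affine⇒toℕ≡ : ∀ {f a s v} → Affine f a s → ∀ i → a + s * toℕ i ≡ₘ v → v < N → toℕ (f i) ≡ v
  Affine⇒toℕ≡ {f} (affine h) i eq v<N = ≡ₘ⇒≡ (toℕ<n (f i)) v<N (≡ₘ-trans (h i) eq)

  ≢ₘ1 : ∀ {x} → 2 ≤ x → x ≤ N → ¬ (x ≡ₘ 1)
  ≢ₘ1 2≤x x≤N (mk eq) with m≤n⇒m<n∨m≡n x≤N
  ... | inj₁ x<N  = <⇒≢ 2≤x (sym (trans (sym (m<n⇒m%n≡m x<N)) eq))
  ... | inj₂ refl = 0≢1+n (trans (sym (n%n≡0 N)) eq)

  0≢ₘ1 : ¬ (0 ≡ₘ 1)
  0≢ₘ1 0≡1 = 0≢1+n (un 0≡1)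

  kreweras-fixes-rotation : ∀ {σ a} → Rotation σ a → kreweras σ ≈ σ → a + a ≡ₘ 1
  kreweras-fixes-rotation {σ} {a} ρ Kσ≈σ =
    ≡ₘ-trans (+-congₘ (≡ₘ-sym offset) ≡ₘ-refl) (oneMinus+≡ₘ1 a)
    where
    offset : oneMinus a ≡ₘ a
    offset = ≈⇒Affine-offset {kreweras σ} {σ} Kσ≈σ (forward (kreweras-rotation ρ)) (forward ρ)

  oneMinus-unique : ∀ {a b} → a + b ≡ₘ 1 → oneMinus a ≡ₘ b
  oneMinus-unique {a} {b} a+b≡1 =
    +-cancelʳ-≡ₘ a (≡ₘ-trans (oneMinus+≡ₘ1 a) (≡ₘ-trans (≡ₘ-sym a+b≡1) (≡⇒≡ₘ (+-comm a b))))

  rotation-fixed : ∀ {σ a} → Rotation σ a → a + a ≡ₘ 1 → kreweras σ ≈ σ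
  rotation-fixed {σ} ρ 2a≡1 = Affine⇒≈ {kreweras σ} {σ} (forward (kreweras-rotation ρ))
    (Affine-resp (forward ρ) (≡ₘ-sym (oneMinus-unique 2a≡1)) ≡ₘ-refl)

  rotation-orbitSize2 : ∀ {σ a} → Rotation σ a → ¬ (a + a ≡ₘ 1) → OrbitSize σ 2
  rotation-orbitSize2 {σ} ρ 2a≢1 =
    s≤s z≤n , Affine⇒≈ {krewerasIter 2 σ} {σ} (forward (krewerasIter-double-rotation ρ 1)) (forward ρ) , minimal
    where
    minimal : ∀ j → 1 ≤ j → j < 2 → ¬ (krewerasIter j σ ≈ σ)
    minimal (suc zero)    _ _                 Kσ≈σ = 2a≢1 (kreweras-fixes-rotation ρ Kσ≈σ)
    minimal (suc (suc j)) _ (s≤s (s≤s ()))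

  a+a≡ₘ1⇒a+a≡1+N : ∀ {a} → a < N → a + a ≡ₘ 1 → a + a ≡ suc N
  a+a≡ₘ1⇒a+a≡1+N {a} a<N 2a≡1 with a + a <? N
  ... | yes 2a<N = ⊥-elim (m+m≢1+n+n a 0 (≡ₘ⇒≡ 2a<N (s≤s (s≤s z≤n)) 2a≡1))
  ... | no  2a≮N = trans (sym (m∸n+n≡m N≤2a)) (cong (_+ N) r≡1)
    where
    N≤2a = ≮⇒≥ 2a≮N
    r<N : a + a ∸ N < N
    r<N = subst (a + a ∸ N <_) (m+n∸n≡m N N) (∸-monoˡ-< (+-mono-< a<N a<N) N≤2a)
    r≡1 : a + a ∸ N ≡ 1
    r≡1 = ≡ₘ⇒≡ r<N (s≤s (s≤s z≤n)) (begin
      a + a ∸ N              ≈⟨ +-N-≡ₘ (a + a ∸ N) ⟨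
      a + a ∸ N + N          ≡⟨ m∸n+n≡m N≤2a ⟩
      a + a                  ≈⟨ 2a≡1 ⟩
      1                      ∎)
      where open ≡ₘ-Reasoning

  m : ℕ
  m = N / 2

  N≡N%2+m+m : N ≡ N % 2 + (m + m)
  N≡N%2+m+m = trans (m≡m%n+[m/n]*n N 2) (cong (N % 2 +_) (trans (*-comm m 2) (cong (m +_) (+-identityʳ m))))

  odd⇒N≡1+m+m : N % 2 ≡ 1 → N ≡ suc (m + m)
  odd⇒N≡1+m+m N%2≡1 = trans N≡N%2+m+m (cong (_+ (m + m)) N%2≡1)

  even⇒N≡m+m : N % 2 ≡ 0 → N ≡ m + m
  even⇒N≡m+m N%2≡0 = trans N≡N%2+m+m (cong (_+ (m + m)) N%2≡0)

  m+m≤N : m + m ≤ N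
  m+m≤N = subst (m + m ≤_) (sym N≡N%2+m+m) (m≤n+m (m + m) (N % 2))

  N≤1+m+m : N ≤ suc (m + m)
  N≤1+m+m = subst (_≤ suc (m + m)) (sym N≡N%2+m+m) (+-monoˡ-≤ (m + m) (<⇒≤pred (m%n<n N 2)))

  1≤m : 1 ≤ m
  1≤m = m≥n⇒m/n>0 {N} {2} (s≤s (s≤s z≤n))

  m<N : m < N
  m<N = m/n<m N 2 (s≤s (s≤s z≤n))

  shiftWord-line : N ≡ suc (m + m) → ∀ {σ} → Rotation σ (suc m) → HasOneLine σ (shiftWord N)
  shiftWord-line N≡1+2m {σ} ρ i with toℕ i <? m
  ... | yes x<m = trans (cong suc σi≡) (trans (cong suc (+-comm (suc m) x)) (sym (if-<ᵇ x<m)))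
    where
    x = toℕ i
    σi≡ : toℕ (σ ⟨$⟩ʳ i) ≡ suc m + x
    σi≡ = Affine⇒toℕ≡ (forward ρ) i (≡⇒≡ₘ (cong (suc m +_) (*-identityˡ x)))
            (subst (suc m + x <_) (sym N≡1+2m) (s≤s (+-monoʳ-< m x<m)))
  ... | no x≮m = trans (cong suc σi≡) (trans (sym (+-∸-assoc 1 m≤x)) (sym (if-≮ᵇ m≤x)))
    where
    x = toℕ i
    m≤x = ≮⇒≥ x≮m
    shift : ∀ y m → suc m + 1 * (y + m) ≡ y + suc (m + m)
    shift = solve-∀
    σi≡ : toℕ (σ ⟨$⟩ʳ i) ≡ x ∸ m
    σi≡ = Affine⇒toℕ≡ (forward ρ) i (begin
      suc m + 1 * x                ≡⟨ cong (λ y → suc m + 1 * y) (m∸n+n≡m m≤x) ⟨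
      suc m + 1 * (x ∸ m + m)      ≡⟨ shift (x ∸ m) m ⟩
      x ∸ m + suc (m + m)          ≡⟨ cong (x ∸ m +_) N≡1+2m ⟨
      x ∸ m + N                    ≈⟨ +-N-≡ₘ (x ∸ m) ⟩
      x ∸ m                        ∎)
      (≤-<-trans (m∸n≤m x m) (toℕ<n i))
      where open ≡ₘ-Reasoning

  orbitSize1⇒offset : ∀ {σ} → OrbitSize σ 1 →
    Rotation σ (toℕ (σ ⟨$⟩ʳ zero)) × toℕ (σ ⟨$⟩ʳ zero) + toℕ (σ ⟨$⟩ʳ zero) ≡ suc N
  orbitSize1⇒offset {σ} (_ , Kσ≈σ , _) =
    ρ , a+a≡ₘ1⇒a+a≡1+N (toℕ<n (σ ⟨$⟩ʳ zero)) (kreweras-fixes-rotation ρ Kσ≈σ)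
    where
    ρ = commuting⇒Rotation {σ} (λ i → trans (kreweras-cong {σ = kreweras σ} {σ} Kσ≈σ i) (Kσ≈σ i))

  odd⇒orbitSize1 : N % 2 ≡ 1 → ∃ λ σ → HasOneLine σ (shiftWord N) × OrbitSize σ 1
  odd⇒orbitSize1 N%2≡1 = rotation (suc m) , shiftWord-line N≡1+2m ρ , s≤s z≤n ,
    rotation-fixed ρ 2a≡1 , λ j 1≤j j<1 _ → ≤⇒≯ 1≤j j<1
    where
    N≡1+2m = odd⇒N≡1+m+m N%2≡1
    ρ = rotation-isRotation (suc m)
    2a≡1 : suc m + suc m ≡ₘ 1
    2a≡1 = ≡ₘ-trans (≡⇒≡ₘ (cong suc (trans (+-suc m m) (sym N≡1+2m)))) 1+N≡ₘ1

  odd⇒orbitSize1⇒shiftWord : N % 2 ≡ 1 → ∀ σ → OrbitSize σ 1 → HasOneLine σ (shiftWord N)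
  odd⇒orbitSize1⇒shiftWord N%2≡1 σ os = shiftWord-line N≡1+2m (subst (Rotation σ) a≡1+m (proj₁ ρ))
    where
    ρ = orbitSize1⇒offset os
    N≡1+2m = odd⇒N≡1+m+m N%2≡1
    a≡1+m : toℕ (σ ⟨$⟩ʳ zero) ≡ suc m
    a≡1+m = m+m≡n+n⇒m≡n (trans (proj₂ ρ) (trans (cong suc N≡1+2m) (cong suc (sym (+-suc m m)))))

  even⇒¬orbitSize1 : N % 2 ≡ 0 → ∀ σ → ¬ OrbitSize σ 1
  even⇒¬orbitSize1 N%2≡0 σ os =
    m+m≢1+n+n (toℕ (σ ⟨$⟩ʳ zero)) m (trans (proj₂ (orbitSize1⇒offset os)) (cong suc (even⇒N≡m+m N%2≡0)))

  offset-representative : ∀ a → a < N → ¬ (a + a ≡ₘ 1) →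
    ∃ λ b → 1 ≤ b × b ≤ m × (b ≡ₘ a ⊎ oneMinus b ≡ₘ a)
  offset-representative zero    _   _    = 1 , ≤-refl , 1≤m , inj₂ (oneMinus-unique ≡ₘ-refl)
  offset-representative (suc a) a<N 2a≢1 with suc a ≤? m
  ... | yes a≤m = suc a , s≤s z≤n , a≤m , inj₁ ≡ₘ-refl
  ... | no  a≰m = suc (N ∸ A) , s≤s z≤n , N∸A<m , inj₂ (oneMinus-unique b+A≡1)
    where
    A   = suc a
    A≤N = <⇒≤ a<N
    b+A≡1+N : suc (N ∸ A) + A ≡ suc N
    b+A≡1+N = cong suc (m∸n+n≡m A≤N)
    b+A≡1 : suc (N ∸ A) + A ≡ₘ 1
    b+A≡1 = ≡ₘ-trans (≡⇒≡ₘ b+A≡1+N) 1+N≡ₘ1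
    -- Otherwise N = 2m + 1 and A = m + 1, the excluded solution of 2A ≡ 1.
    N∸A<m : N ∸ A < m
    N∸A<m with N ∸ A <? m
    ... | yes N∸A<m = N∸A<m
    ... | no  N∸A≮m = ⊥-elim (2a≢1 (≡ₘ-trans (≡⇒≡ₘ 2A≡1+N) 1+N≡ₘ1))
      where
      1+m≤A = ≰⇒> a≰m
      A+m≤1+m+m : A + m ≤ suc m + m
      A+m≤1+m+m = ≤-trans (+-monoʳ-≤ A (≮⇒≥ N∸A≮m))
                    (≤-trans (≤-reflexive (m+[n∸m]≡n A≤N)) N≤1+m+m)
      A+m≡N : A + m ≡ N
      A+m≡N = ≤-antisym (≤-trans (+-monoʳ-≤ A (≮⇒≥ N∸A≮m)) (≤-reflexive (m+[n∸m]≡n A≤N)))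
                (≤-trans N≤1+m+m (+-monoˡ-≤ m 1+m≤A))
      A≡1+m : A ≡ suc m
      A≡1+m = ≤-antisym (+-cancelʳ-≤ m A (suc m) A+m≤1+m+m) 1+m≤A
      2A≡1+N : A + A ≡ suc N
      2A≡1+N = begin
        A + A          ≡⟨ cong (A +_) A≡1+m ⟩
        A + suc m      ≡⟨ +-suc A m ⟩
        suc (A + m)    ≡⟨ cong suc A+m≡N ⟩
        suc N          ∎
        where open ≡-Reasoning

  sameOrbit-rotations : ∀ {σ τ a b} → Rotation σ a → Rotation τ b →
    1 ≤ a → a ≤ m → 1 ≤ b → b ≤ m → SameOrbit σ τ → a ≡ b
  sameOrbit-rotations {σ} {τ} {a} {b} ρ ρ′ 1≤a a≤m 1≤b b≤m (k , Kᵏσ≈τ) with even-or-odd k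
  ... | j , inj₁ refl = ≡ₘ⇒≡ (≤-<-trans a≤m m<N) (≤-<-trans b≤m m<N)
    (≈⇒Affine-offset {krewerasIter (double j) σ} {τ} Kᵏσ≈τ (forward (krewerasIter-double-rotation ρ j)) (forward ρ′))
  ... | j , inj₂ refl = ⊥-elim (≢ₘ1 (+-mono-≤ 1≤a 1≤b) (≤-trans (+-mono-≤ a≤m b≤m) m+m≤N) a+b≡1)
    where
    1-a≡b : oneMinus a ≡ₘ b
    1-a≡b = ≈⇒Affine-offset {krewerasIter (suc (double j)) σ} {τ} Kᵏσ≈τ
      (forward (kreweras-rotation (krewerasIter-double-rotation ρ j))) (forward ρ′)
    a+b≡1 : a + b ≡ₘ 1
    a+b≡1 = ≡ₘ-trans (+-congˡₘ a (≡ₘ-sym 1-a≡b)) (≡ₘ-trans (≡⇒≡ₘ (+-comm a _)) (oneMinus+≡ₘ1 a))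

  rotations-sameOrbit : ∀ {σ τ a b} → Rotation σ a → Rotation τ b →
    b ≡ₘ a ⊎ oneMinus b ≡ₘ a → SameOrbit τ σ
  rotations-sameOrbit {σ} {τ} ρ ρ′ (inj₁ b≡a) =
    0 , Affine⇒≈ {τ} {σ} (forward ρ′) (Affine-resp (forward ρ) (≡ₘ-sym b≡a) ≡ₘ-refl)
  rotations-sameOrbit {σ} {τ} ρ ρ′ (inj₂ 1-b≡a) =
    1 , Affine⇒≈ {kreweras τ} {σ} (forward (kreweras-rotation ρ′)) (Affine-resp (forward ρ) (≡ₘ-sym 1-b≡a) ≡ₘ-refl)

  orbitSize2⇒rotation : ∀ {σ} → OrbitSize σ 2 →
    Rotation σ (toℕ (σ ⟨$⟩ʳ zero)) × ¬ (toℕ (σ ⟨$⟩ʳ zero) + toℕ (σ ⟨$⟩ʳ zero) ≡ₘ 1)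
  orbitSize2⇒rotation {σ} (_ , K²σ≈σ , minimal) = ρ , λ 2a≡1 → minimal 1 ≤-refl ≤-refl (rotation-fixed ρ 2a≡1)
    where ρ = commuting⇒Rotation {σ} K²σ≈σ

  orbitsOfSize2 : ExactlyOrbitsOfSize N m 2
  orbitsOfSize2 = reps , (λ x → rotation-orbitSize2 (reps-rotation x) (2a≢1 x)) , distinct , complete
    where
    reps : Vec (Permutation′ N) m
    reps = tabulate (λ x → rotation (suc (toℕ x)))
    reps-rotation : ∀ x → Rotation (lookup reps x) (suc (toℕ x))
    reps-rotation x = subst (λ τ → Rotation τ (suc (toℕ x)))
      (sym (lookup∘tabulate (λ x → rotation (suc (toℕ x))) x)) (rotation-isRotation _)
    2a≢1 : ∀ (x : Fin m) → ¬ (suc (toℕ x) + suc (toℕ x) ≡ₘ 1)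
    2a≢1 x = ≢ₘ1 (+-mono-≤ (s≤s z≤n) (s≤s z≤n)) (≤-trans (+-mono-≤ (toℕ<n x) (toℕ<n x)) m+m≤N)
    distinct : ∀ x y → SameOrbit (lookup reps x) (lookup reps y) → x ≡ y
    distinct x y same = toℕ-injective (suc-injective
      (sameOrbit-rotations (reps-rotation x) (reps-rotation y) (s≤s z≤n) (toℕ<n x) (s≤s z≤n) (toℕ<n y) same))
    complete : ∀ σ → OrbitSize σ 2 → ∃ λ x → SameOrbit (lookup reps x) σ
    complete σ os = reached (proj₁ ρ) (offset-representative _ (toℕ<n (σ ⟨$⟩ʳ zero)) (proj₂ ρ))
      where
      ρ = orbitSize2⇒rotation os
      reached : ∀ {a} → Rotation σ a → (∃ λ b → 1 ≤ b × b ≤ m × (b ≡ₘ a ⊎ oneMinus b ≡ₘ a)) →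
        ∃ λ x → SameOrbit (lookup reps x) σ
      reached ρ (suc b , _ , b<m , b~a) = fromℕ< b<m , rotations-sameOrbit ρ
        (subst (λ y → Rotation (lookup reps (fromℕ< b<m)) (suc y)) (toℕ-fromℕ< b<m) (reps-rotation _)) b~a

  id-orbitSize2 : OrbitSize {N} id 2
  id-orbitSize2 = rotation-orbitSize2 (forward-id , Affine⇒Affine⁻¹ {id} forward-id ≡ₘ-refl (N-1*a+a≡ₘ0 0))
                    0≢ₘ1
    where
    forward-id : Affine (id ⟨$⟩ʳ_) 0 1
    forward-id = affine λ i → ≡⇒≡ₘ (sym (+-identityʳ (toℕ i)))

  -- Reflections: the orbit of the reversal

  Reflection : Permutation′ N → ℕ → Set
  Reflection σ b = AffinePermutation σ b N-1 b N-1

  Reflection-resp : ∀ {σ b b′} → Reflection σ b → b ≡ b′ → Reflection σ b′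
  Reflection-resp ρ refl = ρ

  kreweras-reflection : ∀ {σ b} → Reflection σ b → Reflection (kreweras σ) (suc b)
  kreweras-reflection {σ} {b} ρ = forward Kρ ,
    Affine-resp (backward Kρ) (≡ₘ-trans (+-congˡₘ b N-1*N-1≡ₘ1) (≡⇒≡ₘ (+-comm b 1))) ≡ₘ-refl
    where Kρ = kreweras-affine ρ

  krewerasIter-reflection : ∀ {σ b} → Reflection σ b → ∀ k → Reflection (krewerasIter k σ) (b + k)
  krewerasIter-reflection {b = b} ρ zero    = Reflection-resp ρ (sym (+-identityʳ b))
  krewerasIter-reflection {b = b} ρ (suc k) =
    Reflection-resp (kreweras-reflection (krewerasIter-reflection ρ k)) (sym (+-suc b k))

  N-1+N-1*N-1≡ₘ0 : N-1 + N-1 * N-1 ≡ₘ 0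
  N-1+N-1*N-1≡ₘ0 = ≡ₘ-trans (+-congˡₘ N-1 N-1*N-1≡ₘ1) (≡ₘ-trans (≡⇒≡ₘ (+-comm N-1 1)) N≡ₘ0)

  reverse : Permutation′ N
  reverse = affinePermutation N-1 N-1 N-1 N-1 N-1*N-1≡ₘ1 N-1+N-1*N-1≡ₘ0

  reverse-reflection : Reflection reverse N-1
  reverse-reflection = affinePermutation-affine N-1 N-1 N-1 N-1 N-1*N-1≡ₘ1 N-1+N-1*N-1≡ₘ0

  reverse-line : HasOneLine reverse (reverseWord N)
  reverse-line i = trans (cong suc reverse-i) (sym (+-∸-assoc 1 x≤N-1))
    where
    x = toℕ i
    x≤N-1 = <⇒≤pred (toℕ<n i)
    reflect : ∀ x p → (suc p + suc p * x) + x ≡ suc p + x * suc (suc p)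
    reflect = solve-∀
    reverse-i : toℕ (reverse ⟨$⟩ʳ i) ≡ N-1 ∸ x
    reverse-i = Affine⇒toℕ≡ (forward reverse-reflection) i (+-cancelʳ-≡ₘ x (begin
      N-1 + N-1 * x + x     ≡⟨ reflect x p ⟩
      N-1 + x * N           ≈⟨ +-*N-≡ₘ N-1 x ⟩
      N-1                   ≡⟨ m∸n+n≡m x≤N-1 ⟨
      N-1 ∸ x + x           ∎)) (s≤s (m∸n≤m N-1 x))
      where open ≡ₘ-Reasoning

  reverse-orbitSizeN : ∃ λ σ → HasOneLine σ (reverseWord N) × OrbitSize σ N
  reverse-orbitSizeN = reverse , reverse-line , s≤s z≤n ,
    Affine⇒≈ {krewerasIter N reverse} {reverse}
      (Affine-resp (forward (krewerasIter-reflection reverse-reflection N)) (+-N-≡ₘ N-1) ≡ₘ-refl)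
      (forward reverse-reflection) ,
    minimal
    where
    minimal : ∀ j → 1 ≤ j → j < N → ¬ (krewerasIter j reverse ≈ reverse)
    minimal j 1≤j j<N Kʲrev≈rev = <⇒≢ 1≤j (sym (≡ₘ⇒≡ j<N (s≤s z≤n) j≡0))
      where
      N-1+j≡N-1 : N-1 + j ≡ₘ N-1
      N-1+j≡N-1 = ≈⇒Affine-offset {krewerasIter j reverse} {reverse} Kʲrev≈rev
        (forward (krewerasIter-reflection reverse-reflection j)) (forward reverse-reflection)
      j≡0 : j ≡ₘ 0
      j≡0 = +-cancelʳ-≡ₘ N-1 (≡ₘ-trans (≡⇒≡ₘ (+-comm j N-1)) N-1+j≡N-1)

  -- Orbits of size 2N

  orbitSize-2N : ∀ {σ} →
    (∀ k → 1 ≤ k → k < N → ¬ (krewerasIter (double k) σ ≈ σ)) →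
    (∀ k → k < N → ¬ (krewerasIter (suc (double k)) σ ≈ σ)) →
    OrbitSize σ (2 * N)
  orbitSize-2N {σ} even odd =
    subst (1 ≤_) (double≡2* N) (s≤s z≤n) ,
    subst (λ j → krewerasIter j σ ≈ σ) (double≡2* N) (krewerasIter-2N σ) ,
    minimal
    where
    minimal : ∀ j → 1 ≤ j → j < 2 * N → ¬ (krewerasIter j σ ≈ σ)
    minimal j 1≤j j<2N with even-or-odd j | subst (j <_) (sym (double≡2* N)) j<2N
    ... | zero  , inj₁ refl | _      = ⊥-elim (≤⇒≯ 1≤j (s≤s z≤n))
    ... | suc k , inj₁ refl | j<2N′ = even (suc k) (s≤s z≤n) (double-cancel-< j<2N′)
    ... | k     , inj₂ refl | j<2N′ = odd k (double-cancel-< (<-trans (n<1+n _) j<2N′))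

  toℕ-cyc^-zero : ∀ {k} → k < N → toℕ (cyc^ k zero) ≡ k
  toℕ-cyc^-zero {k} k<N = ≡ₘ⇒≡ (toℕ<n _) k<N (toℕ-cyc^ k zero)

  commute-toℕ : ∀ {σ} k → krewerasIter (double k) σ ≈ σ →
    ∀ i → toℕ (σ ⟨$⟩ʳ cyc^ k i) ≡ₘ toℕ (σ ⟨$⟩ʳ i) + k
  commute-toℕ {σ} k K²ᵏσ≈σ i =
    ≡ₘ-trans (≡⇒≡ₘ (cong toℕ (commute-cyc^ {σ = σ} k K²ᵏσ≈σ i))) (toℕ-cyc^ k (σ ⟨$⟩ʳ i))

  anticommute-toℕ : ∀ {σ} k → krewerasIter (suc (double k)) σ ≈ σ →
    ∀ i → toℕ (σ ⟨$⟩ʳ cyc^ k i) ≡ₘ suc (toℕ (σ ⟨$⟩ˡ i) + k)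
  anticommute-toℕ {σ} k K²ᵏ⁺¹σ≈σ i =
    ≡ₘ-trans (≡⇒≡ₘ (cong toℕ (anticommute-cyc^ {σ = σ} k K²ᵏ⁺¹σ≈σ i)))
      (≡ₘ-trans (toℕ-cycʳ _) (+-congˡₘ 1 (toℕ-cyc^ k (σ ⟨$⟩ˡ i))))

  module OddOrbit (N≡1+2m : N ≡ suc (m + m)) (2≤m : 2 ≤ m) where
    [1+m]*2≡ₘ1 : suc m * 2 ≡ₘ 1
    [1+m]*2≡ₘ1 = ≡ₘ-trans (≡⇒≡ₘ (trans (expand m) (cong (1 +_) (sym N≡1+2m)))) 1+N≡ₘ1
      where
      expand : ∀ m → suc m * 2 ≡ 1 + suc (m + m)
      expand = solve-∀

    doubling : Permutation′ N
    doubling = affinePermutation 0 2 0 (suc m) [1+m]*2≡ₘ1 (≡⇒≡ₘ (*-zeroʳ (suc m)))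

    doubling-affine : AffinePermutation doubling 0 2 0 (suc m)
    doubling-affine = affinePermutation-affine 0 2 0 (suc m) [1+m]*2≡ₘ1 (≡⇒≡ₘ (*-zeroʳ (suc m)))

    doubling-toℕ : ∀ i → toℕ (doubling ⟨$⟩ʳ i) ≡ₘ 2 * toℕ i
    doubling-toℕ = apply (forward doubling-affine)

    ¬even-period : ∀ k → 1 ≤ k → k < N → ¬ (krewerasIter (double k) doubling ≈ doubling)
    ¬even-period k 1≤k k<N K²ᵏσ≈σ = <⇒≢ 1≤k (sym (≡ₘ⇒≡ k<N (s≤s z≤n) (+-cancelʳ-≡ₘ k k+k≡k)))
      where
      k+k≡k : k + k ≡ₘ 0 + k
      k+k≡k = begin
        k + k                               ≡⟨ cong (k +_) (+-identityʳ k) ⟨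
        2 * k                               ≡⟨ cong (2 *_) (toℕ-cyc^-zero k<N) ⟨
        2 * toℕ (cyc^ k zero)               ≈⟨ doubling-toℕ (cyc^ k zero) ⟨
        toℕ (doubling ⟨$⟩ʳ cyc^ k zero)     ≈⟨ commute-toℕ k K²ᵏσ≈σ zero ⟩
        toℕ (doubling ⟨$⟩ʳ zero) + k        ≈⟨ +-congₘ (doubling-toℕ zero) ≡ₘ-refl ⟩
        0 + k                               ∎
        where open ≡ₘ-Reasoning

    ¬odd-period : ∀ k → k < N → ¬ (krewerasIter (suc (double k)) doubling ≈ doubling)
    ¬odd-period k k<N K²ᵏ⁺¹σ≈σ = <⇒≢ 2≤m (suc-injective (≡ₘ⇒≡ 2<N 1+m<N 2≡1+m))
      where
      at : ∀ i → 2 * (toℕ i + k) ≡ₘ suc (suc m * toℕ i + k)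
      at i = begin
        2 * (toℕ i + k)                      ≈⟨ *-congˡₘ 2 (toℕ-cyc^ k i) ⟨
        2 * toℕ (cyc^ k i)                   ≈⟨ doubling-toℕ (cyc^ k i) ⟨
        toℕ (doubling ⟨$⟩ʳ cyc^ k i)         ≈⟨ anticommute-toℕ k K²ᵏ⁺¹σ≈σ i ⟩
        suc (toℕ (doubling ⟨$⟩ˡ i) + k)      ≈⟨ +-congˡₘ 1 (+-congₘ (apply (backward doubling-affine) i) ≡ₘ-refl) ⟩
        suc (suc m * toℕ i + k)              ∎
        where open ≡ₘ-Reasoning
      -- Subtract the equation at 0 from the one at 1.
      2≡1+m : 2 ≡ₘ suc m
      2≡1+m = +-cancelʳ-≡ₘ (2 * k) (begin
        2 + 2 * k                ≡⟨ 2*-suc k ⟨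
        2 * (1 + k)              ≈⟨ at (suc zero) ⟩
        suc (suc m * 1 + k)      ≡⟨ regroup m k ⟩
        suc m + suc (suc m * 0 + k) ≈⟨ +-congˡₘ (suc m) (at zero) ⟨
        suc m + 2 * (0 + k)      ∎)
        where
        open ≡ₘ-Reasoning
        regroup : ∀ m k → suc (suc m * 1 + k) ≡ suc m + suc (suc m * 0 + k)
        regroup = solve-∀
      1+m<N : suc m < N
      1+m<N = subst (suc m <_) (sym N≡1+2m) (s≤s (subst (_≤ m + m) (+-comm m 1) (+-monoʳ-≤ m 1≤m)))
      2<N : 2 < N
      2<N = ≤-<-trans 2≤m (≤-<-trans (n≤1+n m) 1+m<N)

    doubling-line : HasOneLine doubling (oddsEvensWordOdd N)
    doubling-line i with toℕ i <? suc m
    ... | yes x<1+m = trans (cong suc σi≡2x) (trans (cong (_∸ 1) (sym (2*-suc x))) (sym (if-<ᵇ x<1+m)))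
      where
      x = toℕ i
      2x<N : 2 * x < N
      2x<N = subst₂ _<_ (cong (x +_) (sym (+-identityʳ x))) (sym N≡1+2m)
               (s≤s (+-mono-≤ (<⇒≤pred x<1+m) (<⇒≤pred x<1+m)))
      σi≡2x : toℕ (doubling ⟨$⟩ʳ i) ≡ 2 * x
      σi≡2x = Affine⇒toℕ≡ (forward doubling-affine) i ≡ₘ-refl 2x<N
    ... | no x≮1+m = trans (cong suc σi≡1+2y)
                       (trans (sym (2*-suc y)) (trans (cong (2 *_) (sym x∸m≡1+y)) (sym (if-≮ᵇ 1+m≤x))))
      where
      x = toℕ i
      1+m≤x = ≮⇒≥ x≮1+m
      y = x ∸ suc m
      x∸m≡1+y : x ∸ m ≡ suc y
      x∸m≡1+y = +-∸-assoc 1 1+m≤x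
      y<m : y < m
      y<m = +-cancelˡ-< (suc m) y m (subst₂ _<_ (sym (m+[n∸m]≡n 1+m≤x)) N≡1+2m (toℕ<n i))
      expand : ∀ m y → 2 * (suc m + y) ≡ suc (2 * y) + suc (m + m)
      expand = solve-∀
      σi≡1+2y : toℕ (doubling ⟨$⟩ʳ i) ≡ suc (2 * y)
      σi≡1+2y = Affine⇒toℕ≡ (forward doubling-affine) i (begin
        2 * x                          ≡⟨ cong (2 *_) (m+[n∸m]≡n 1+m≤x) ⟨
        2 * (suc m + y)                ≡⟨ expand m y ⟩
        suc (2 * y) + suc (m + m)      ≡⟨ cong (suc (2 * y) +_) N≡1+2m ⟨
        suc (2 * y) + N                ≈⟨ +-N-≡ₘ (suc (2 * y)) ⟩
        suc (2 * y)                    ∎)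
        (subst₂ _<_ (cong (λ z → suc (y + z)) (sym (+-identityʳ y))) (sym N≡1+2m) (s≤s (+-mono-< y<m y<m)))
        where open ≡ₘ-Reasoning

    oddsEvens-orbitSize2N : ∃ λ σ → HasOneLine σ (oddsEvensWordOdd N) × OrbitSize σ (2 * N)
    oddsEvens-orbitSize2N = doubling , doubling-line , orbitSize-2N ¬even-period ¬odd-period

  module EvenOrbit (N≡2m : N ≡ double m) (2≤m : 2 ≤ m) where
    shuffle unshuffle : ℕ → ℕ
    shuffle x = if x <ᵇ m then double x else suc (double (x ∸ m))

    unshuffle zero          = zero
    unshuffle (suc zero)    = m
    unshuffle (suc (suc v)) = suc (unshuffle v)

    unshuffle-double : ∀ k → unshuffle (double k) ≡ k
    unshuffle-double zero    = refl
    unshuffle-double (suc k) = cong suc (unshuffle-double k)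

    unshuffle-1+double : ∀ k → unshuffle (suc (double k)) ≡ m + k
    unshuffle-1+double zero    = sym (+-identityʳ m)
    unshuffle-1+double (suc k) = trans (cong suc (unshuffle-1+double k)) (sym (+-suc m k))

    x∸m<m : ∀ {x} → x < N → x ∸ m < m
    x∸m<m {x} x<N = m<n+o⇒m∸n<o x m {{>-nonZero (≤-trans (s≤s z≤n) 2≤m)}}
                      (subst (x <_) (trans N≡2m (double≡+ m)) x<N)

    double<N : ∀ {k} → k < m → double k < N
    double<N k<m = subst (_ <_) (sym N≡2m) (<-trans (n<1+n _) (1+double<double k<m))

    1+double<N : ∀ {k} → k < m → suc (double k) < N
    1+double<N k<m = subst (_ <_) (sym N≡2m) (1+double<double k<m)

    shuffle-<N : ∀ {x} → x < N → shuffle x < N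
    shuffle-<N {x} x<N with x <? m
    ... | yes x<m = subst (_< N) (sym (if-<ᵇ x<m)) (double<N x<m)
    ... | no  x≮m = subst (_< N) (sym (if-≮ᵇ (≮⇒≥ x≮m))) (1+double<N (x∸m<m x<N))

    shuffleRange : RangePermutation N
    shuffleRange = record
      { to = shuffle ; from = unshuffle ; to-< = shuffle-<N ; from-< = from-<
      ; from∘to = from∘to ; to∘from = to∘from }
      where
      from-< : ∀ {v} → v < N → unshuffle v < N
      from-< {v} v<N with even-or-odd v
      ... | k , inj₁ refl = subst (_< N) (sym (unshuffle-double k))
        (<-trans (double-cancel-< (subst (double k <_) N≡2m v<N)) m<N)
      ... | k , inj₂ refl = subst₂ _<_ (sym (unshuffle-1+double k)) (sym (trans N≡2m (double≡+ m)))
        (+-monoʳ-< m (double-cancel-< (subst (double k <_) N≡2m (<-trans (n<1+n _) v<N))))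
      from∘to : ∀ {x} → x < N → unshuffle (shuffle x) ≡ x
      from∘to {x} x<N with x <? m
      ... | yes x<m = trans (cong unshuffle (if-<ᵇ x<m)) (unshuffle-double x)
      ... | no  x≮m = trans (cong unshuffle (if-≮ᵇ (≮⇒≥ x≮m)))
                        (trans (unshuffle-1+double (x ∸ m)) (m+[n∸m]≡n (≮⇒≥ x≮m)))
      to∘from : ∀ {v} → v < N → shuffle (unshuffle v) ≡ v
      to∘from {v} v<N with even-or-odd v
      ... | k , inj₁ refl = trans (cong shuffle (unshuffle-double k))
        (if-<ᵇ (double-cancel-< (subst (double k <_) N≡2m v<N)))
      ... | k , inj₂ refl = trans (cong shuffle (unshuffle-1+double k))
        (trans (if-≮ᵇ (m≤m+n m k)) (cong (λ y → suc (double y)) (m+n∸m≡n m k)))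

    shuffling : Permutation′ N
    shuffling = toPermutation shuffleRange

    shuffling-toℕʳ : ∀ i → toℕ (shuffling ⟨$⟩ʳ i) ≡ shuffle (toℕ i)
    shuffling-toℕʳ = toℕ-toPermutationʳ shuffleRange

    shuffling-toℕˡ : ∀ i → toℕ (shuffling ⟨$⟩ˡ i) ≡ unshuffle (toℕ i)
    shuffling-toℕˡ = toℕ-toPermutationˡ shuffleRange

    shuffle-0 : shuffle 0 ≡ 0
    shuffle-0 = if-<ᵇ (≤-trans (s≤s z≤n) 2≤m)

    shuffle-1 : shuffle 1 ≡ 2
    shuffle-1 = if-<ᵇ 2≤m

    unshuffle-N-1 : unshuffle N-1 ≡ N-1
    unshuffle-N-1 = begin
      unshuffle N-1                ≡⟨ cong unshuffle N-1≡1+2m′ ⟩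
      unshuffle (suc (double m′))  ≡⟨ unshuffle-1+double m′ ⟩
      m + m′                       ≡⟨ cong (_+ m′) m≡1+m′ ⟩
      suc (m′ + m′)                ≡⟨ cong suc (double≡+ m′) ⟨
      suc (double m′)              ≡⟨ N-1≡1+2m′ ⟨
      N-1                          ∎
      where
      open ≡-Reasoning
      m′  = m ∸ 1
      m≡1+m′ : m ≡ suc m′
      m≡1+m′ = sym (m+[n∸m]≡n 1≤m)
      N-1≡1+2m′ : N-1 ≡ suc (double m′)
      N-1≡1+2m′ = suc-injective (trans N≡2m (cong double m≡1+m′))

    shuffle-fixed : ∀ {k} → 1 ≤ k → shuffle k ≡ k → suc k ≡ N
    shuffle-fixed {k} 1≤k fixed with k <? m
    ... | yes k<m = ⊥-elim (<⇒≢ 1≤k (sym (+-cancelˡ-≡ k k 0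
                      (trans (sym (double≡+ k)) (trans (sym (if-<ᵇ k<m)) (trans fixed (sym (+-identityʳ k))))))))
    ... | no  k≮m = begin
      suc k        ≡⟨ cong suc (m+[n∸m]≡n m≤k) ⟨
      suc (m + y)  ≡⟨ +-suc m y ⟨
      m + suc y    ≡⟨ cong (m +_) 1+y≡m ⟩
      m + m        ≡⟨ double≡+ m ⟨
      double m     ≡⟨ N≡2m ⟨
      N            ∎
      where
      open ≡-Reasoning
      m≤k = ≮⇒≥ k≮m
      y   = k ∸ m
      1+y≡m : suc y ≡ m
      1+y≡m = +-cancelʳ-≡ y (suc y) m (begin
        suc (y + y)        ≡⟨ cong suc (double≡+ y) ⟨
        suc (double y)     ≡⟨ if-≮ᵇ m≤k ⟨
        shuffle k          ≡⟨ fixed ⟩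
        k                  ≡⟨ m+[n∸m]≡n m≤k ⟨
        m + y              ∎)

    shuffle-successor : ∀ {k} → k < N → shuffle k ≡ₘ suc k → k ≡ 1
    shuffle-successor {k} k<N shifted with k <? m
    ... | yes k<m = +-cancelˡ-≡ k k 1 (trans (sym (double≡+ k)) (trans (sym (if-<ᵇ k<m))
                      (trans (≡ₘ⇒≡ (shuffle-<N k<N) (≤-<-trans k<m m<N) shifted) (+-comm 1 k))))
    ... | no  k≮m with m≤n⇒m<n∨m≡n k<N
    ...   | inj₁ 1+k<N = ⊥-elim (<⇒≢ (x∸m<m k<N) (+-cancelʳ-≡ y y m (begin
      y + y              ≡⟨ double≡+ y ⟨
      double y           ≡⟨ suc-injective (trans (sym (if-≮ᵇ m≤k)) (≡ₘ⇒≡ (shuffle-<N k<N) 1+k<N shifted)) ⟩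
      k                  ≡⟨ m+[n∸m]≡n m≤k ⟨
      m + y              ∎)))
      where
      open ≡-Reasoning
      m≤k = ≮⇒≥ k≮m
      y   = k ∸ m
    ...   | inj₂ 1+k≡N = ⊥-elim (1+n≢0 (trans (sym (if-≮ᵇ (≮⇒≥ k≮m)))
              (≡ₘ⇒≡ (shuffle-<N k<N) (s≤s z≤n) (≡ₘ-trans shifted (≡ₘ-trans (≡⇒≡ₘ 1+k≡N) N≡ₘ0)))))

    -- At 0, commuting with c^k makes k a nonzero fixed point of shuffle, so k = N-1;
    -- at 1 it then gives shuffle 0 ≡ shuffle 1 + N - 1 ≡ 1.
    ¬even-period : ∀ k → 1 ≤ k → k < N → ¬ (krewerasIter (double k) shuffling ≈ shuffling)
    ¬even-period k 1≤k k<N K²ᵏσ≈σ = 0≢ₘ1 (begin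
      0                                          ≡⟨ shuffle-0 ⟨
      shuffle 0                                  ≡⟨ shuffling-toℕʳ zero ⟨
      toℕ (shuffling ⟨$⟩ʳ zero)                  ≡⟨ cong (λ j → toℕ (shuffling ⟨$⟩ʳ j)) (cyc^-wrap {k} {suc zero} 1+k≡N) ⟨
      toℕ (shuffling ⟨$⟩ʳ cyc^ k (suc zero))     ≈⟨ commute-toℕ {shuffling} k K²ᵏσ≈σ (suc zero) ⟩
      toℕ (shuffling ⟨$⟩ʳ suc zero) + k          ≡⟨ cong (_+ k) (trans (shuffling-toℕʳ (suc zero)) shuffle-1) ⟩
      suc (suc k)                                ≡⟨ cong suc 1+k≡N ⟩
      suc N                                      ≈⟨ 1+N≡ₘ1 ⟩
      1                                          ∎)
      where
      open ≡ₘ-Reasoning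
      fixed : shuffle k ≡ k
      fixed = ≡ₘ⇒≡ (shuffle-<N k<N) k<N (begin
        shuffle k                                ≡⟨ cong shuffle (toℕ-cyc^-zero k<N) ⟨
        shuffle (toℕ (cyc^ k zero))              ≡⟨ shuffling-toℕʳ (cyc^ k zero) ⟨
        toℕ (shuffling ⟨$⟩ʳ cyc^ k zero)         ≈⟨ commute-toℕ {shuffling} k K²ᵏσ≈σ zero ⟩
        toℕ (shuffling ⟨$⟩ʳ zero) + k            ≡⟨ cong (_+ k) (trans (shuffling-toℕʳ zero) shuffle-0) ⟩
        k                                        ∎)
      1+k≡N = shuffle-fixed 1≤k fixed

    -- At 0 the identity forces k = 1; at N-1 it then gives shuffle 0 ≡ unshuffle (N-1) + 2 ≡ 1.
    ¬odd-period : ∀ k → k < N → ¬ (krewerasIter (suc (double k)) shuffling ≈ shuffling)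
    ¬odd-period k k<N K²ᵏ⁺¹σ≈σ = 0≢ₘ1 (begin
      0                                          ≡⟨ shuffle-0 ⟨
      shuffle 0                                  ≡⟨ shuffling-toℕʳ zero ⟨
      toℕ (shuffling ⟨$⟩ʳ zero)                  ≡⟨ cong (λ j → toℕ (shuffling ⟨$⟩ʳ j)) (cyc^-wrap {1} {last} last+1≡N) ⟨
      toℕ (shuffling ⟨$⟩ʳ cyc^ 1 last)           ≈⟨ anticommute-toℕ {shuffling} 1 K³σ≈σ last ⟩
      suc (toℕ (shuffling ⟨$⟩ˡ last) + 1)        ≡⟨ cong (λ v → suc (v + 1)) (trans (shuffling-toℕˡ last) unshuffle-last) ⟩
      suc (N-1 + 1)                              ≡⟨ cong suc (+-comm N-1 1) ⟩
      suc N                                      ≈⟨ 1+N≡ₘ1 ⟩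
      1                                          ∎)
      where
      open ≡ₘ-Reasoning
      last = fromℕ N-1
      last+1≡N : toℕ last + 1 ≡ N
      last+1≡N = trans (cong (_+ 1) (toℕ-fromℕ N-1)) (+-comm N-1 1)
      unshuffle-last : unshuffle (toℕ last) ≡ N-1
      unshuffle-last = trans (cong unshuffle (toℕ-fromℕ N-1)) unshuffle-N-1
      k≡1 : k ≡ 1
      k≡1 = shuffle-successor k<N (begin
        shuffle k                                ≡⟨ cong shuffle (toℕ-cyc^-zero k<N) ⟨
        shuffle (toℕ (cyc^ k zero))              ≡⟨ shuffling-toℕʳ (cyc^ k zero) ⟨
        toℕ (shuffling ⟨$⟩ʳ cyc^ k zero)         ≈⟨ anticommute-toℕ {shuffling} k K²ᵏ⁺¹σ≈σ zero ⟩
        suc (toℕ (shuffling ⟨$⟩ˡ zero) + k)      ≡⟨ cong (λ v → suc (v + k)) (shuffling-toℕˡ zero) ⟩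
        suc k                                    ∎)
      K³σ≈σ : krewerasIter 3 shuffling ≈ shuffling
      K³σ≈σ = subst (λ k → krewerasIter (suc (double k)) shuffling ≈ shuffling) k≡1 K²ᵏ⁺¹σ≈σ

    shuffling-line : HasOneLine shuffling (oddsEvensWordEven N)
    shuffling-line i = trans (cong suc (shuffling-toℕʳ i)) (line (toℕ i))
      where
      open ≡-Reasoning
      line : ∀ x → suc (shuffle x) ≡ oddsEvensWordEven N (suc x)
      line x with x <? m
      ... | yes x<m = begin
        suc (shuffle x)              ≡⟨ cong suc (if-<ᵇ x<m) ⟩
        suc (double x)               ≡⟨ cong suc (double≡2* x) ⟩
        suc (2 * x)                  ≡⟨ cong (_∸ 1) (2*-suc x) ⟨
        2 * suc x ∸ 1                ≡⟨ if-<ᵇ x<m ⟨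
        oddsEvensWordEven N (suc x)  ∎
      ... | no  x≮m = begin
        suc (shuffle x)              ≡⟨ cong suc (if-≮ᵇ (≮⇒≥ x≮m)) ⟩
        double (suc (x ∸ m))         ≡⟨ double≡2* (suc (x ∸ m)) ⟩
        2 * suc (x ∸ m)              ≡⟨ cong (2 *_) (+-∸-assoc 1 (≮⇒≥ x≮m)) ⟨
        2 * (suc x ∸ m)              ≡⟨ if-≮ᵇ (≮⇒≥ x≮m) ⟨
        oddsEvensWordEven N (suc x)  ∎

    oddsEvens-orbitSize2N : ∃ λ σ → HasOneLine σ (oddsEvensWordEven N) × OrbitSize σ (2 * N)
    oddsEvens-orbitSize2N = shuffling , shuffling-line , orbitSize-2N ¬even-period ¬odd-period

  3<N⇒2≤m : 3 < N → 2 ≤ m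
  3<N⇒2≤m 3<N with m ≤? 1
  ... | yes m≤1 = ⊥-elim (≤⇒≯ (≤-trans N≤1+m+m (s≤s (+-mono-≤ m≤1 m≤1))) 3<N)
  ... | no  m≰1 = ≰⇒> m≰1

theorem7p9 : (n : ℕ) → 2 ≤ n →
    ((n % 2 ≡ 1 →
        (∃ λ (σ : Permutation′ n) → HasOneLine σ (shiftWord n) × OrbitSize σ 1) ×
        (∀ (σ : Permutation′ n) → OrbitSize σ 1 → HasOneLine σ (shiftWord n))) ×
     (n % 2 ≡ 0 → ∀ (σ : Permutation′ n) → ¬ OrbitSize σ 1)) ×
    (ExactlyOrbitsOfSize n (n / 2) 2 × OrbitSize {n} id 2) ×
    (∃ λ (σ : Permutation′ n) → HasOneLine σ (reverseWord n) × OrbitSize σ n) ×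
    ((3 < n → n % 2 ≡ 0 →
        ∃ λ (σ : Permutation′ n) → HasOneLine σ (oddsEvensWordEven n) × OrbitSize σ (2 * n)) ×
     (3 < n → n % 2 ≡ 1 →
        ∃ λ (σ : Permutation′ n) → HasOneLine σ (oddsEvensWordOdd n) × OrbitSize σ (2 * n)))
theorem7p9 (suc (suc p)) (s≤s (s≤s z≤n)) =
  ((λ odd → odd⇒orbitSize1 odd , odd⇒orbitSize1⇒shiftWord odd) , even⇒¬orbitSize1) ,
  (orbitsOfSize2 , id-orbitSize2) ,
  reverse-orbitSizeN ,
  (λ 3<N even → EvenOrbit.oddsEvens-orbitSize2N (trans (even⇒N≡m+m even) (sym (double≡+ m))) (3<N⇒2≤m 3<N)) ,
  (λ 3<N odd  → OddOrbit.oddsEvens-orbitSize2N (odd⇒N≡1+m+m odd) (3<N⇒2≤m 3<N))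
  where open Modulo p
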